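{- Let $\dot G\in\mathcal C_1\cup\mathcal C_4\cup\mathcal C_5$ be a connected, non-complete, $6$-regular and $2$ net-regular strongly regular signed graph with parameters $(n,6,a,b,c)$. If $\dot G$ contains an unbalanced triangle of the first type, then $a\in\{ -4,-2,-1,0\}$.
   Context: Signed graphs. - A signed graph $\dot G=(G,\sigma)$ is a simple graph $G$ (the underlying graph) with a sign function $\sigma:E(G)\to\{\pm1\}$. - The adjacency matrix has entries $\sigma(v_iv_j)$ for adjacent pairs and $0$ otherwise. - Connected, complete and regular refer to $G$. - $\dot G$ is $\rho$ net-regular if every vertex has (number of positive incident edges) $-$ (number of negative incident edges) $=\rho$. - $\dot G$ is homogeneous if all edges have the same sign. Triangles. - A triangle is unbalanced if the product of its edge signs is $-1$. - An unbalanced triangle is of the first type if exactly one of its edges is negative, and of the second type if all three edges are negative. Strongly regular signed graphs. - An SRSG is a signed graph on $n$ vertices, neither homogeneous complete nor edgeless, for which there are $r\in\mathbb N$ and $a,b,c\in\mathbb Z$ such that the entries of $A(\dot G)^2$ are: - $r$ on the diagonal; - $a$ for pairs joined by a positive edge; - $b$ for pairs joined by a negative edge; - $c$ for distinct non-adjacent pairs. - $(n,r,a,b,c)$ are its parameters. Classes of inhomogeneous SRSGs. - $\mathcal C_1$: $a=-b$, and either complete, or non-complete with $c\ne0$. - $\mathcal C_4$: $a\ne-b$, non-complete, $c=0$. - $\mathcal C_5$: $a\ne-b$, non-complete, $c\ne\frac{a+b}2$ and $c\neq0$. -}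

module Defs where

open import Data.Nat using (ℕ; zero; suc)
open import Data.Integer using (ℤ; +_; -_; _+_; _*_; ∣_∣) renaming (+0 to ℤ0)
open import Data.Fin using (Fin; zero; suc)
open import Data.Product using (_×_; Σ; ∃; ∃-syntax; _,_)
open import Data.Sum using (_⊎_)
open import Relation.Binary.PropositionalEquality using (_≡_; _≢_)
open import Relation.Nullary using (¬_)

sumℤ : {n : ℕ} → (Fin n → ℤ) → ℤ
sumℤ {zero}  f = + 0
sumℤ {suc n} f = f zero + sumℤ (λ k → f (suc k))

sumℕ : {n : ℕ} → (Fin n → ℕ) → ℕ
sumℕ {zero}  f = 0
sumℕ {suc n} f = f zero Data.Nat.+ sumℕ (λ k → f (suc k))

SignEntry : ℤ → Set
SignEntry x = (x ≡ + 0) ⊎ (x ≡ + 1) ⊎ (x ≡ - (+ 1))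

-- A signed graph on vertex set Fin n, given by its adjacency matrix:
-- A i j = σ(ij) if i ~ j, and 0 otherwise (simple: zero diagonal, symmetric).
record SignedGraph (n : ℕ) : Set where
  field
    A       : Fin n → Fin n → ℤ
    entries : ∀ i j → SignEntry (A i j)
    loopless : ∀ i → A i i ≡ + 0
    symm    : ∀ i j → A i j ≡ A j i
open SignedGraph public

module _ {n : ℕ} (G : SignedGraph n) where

  Adj : Fin n → Fin n → Set
  Adj i j = A G i j ≢ + 0

  Pos : Fin n → Fin n → Set
  Pos i j = A G i j ≡ + 1

  Neg : Fin n → Fin n → Set
  Neg i j = A G i j ≡ - (+ 1)

  A² : Fin n → Fin n → ℤ
  A² i j = sumℤ (λ k → A G i k * A G k j)

  -- degree in the underlying graph = number of neighbours
  -- (each entry is 0 or ±1, so |A i k| is 1 exactly for neighbours)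
  deg : Fin n → ℕ
  deg i = sumℕ (λ k → ∣ A G i k ∣)

  Regular : ℕ → Set
  Regular r = ∀ i → deg i ≡ r

  -- net degree = (#positive incident edges) - (#negative incident edges)
  NetRegular : ℤ → Set
  NetRegular ρ = ∀ i → sumℤ (λ k → A G i k) ≡ ρ

  data Walk : Fin n → Fin n → Set where
    here : ∀ {i} → Walk i i
    step : ∀ {i j k} → Adj i j → Walk j k → Walk i k

  Connected : Set
  Connected = ∀ i j → Walk i j

  Complete : Set
  Complete = ∀ i j → i ≢ j → Adj i j

  Edgeless : Set
  Edgeless = ∀ i j → A G i j ≡ + 0

  Homogeneous : Set
  Homogeneous = (∀ i j → Adj i j → Pos i j) ⊎ (∀ i j → Adj i j → Neg i j)

  SRSG : ℕ → ℤ → ℤ → ℤ → Set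
  SRSG r a b c =
    ¬ (Homogeneous × Complete) × ¬ Edgeless ×
    (∀ i → A² i i ≡ + r) ×
    (∀ i j → Pos i j → A² i j ≡ a) ×
    (∀ i j → Neg i j → A² i j ≡ b) ×
    (∀ i j → i ≢ j → A G i j ≡ + 0 → A² i j ≡ c)

  InC₁ : ℤ → ℤ → ℤ → Set
  InC₁ a b c = a ≡ - b × (Complete ⊎ (¬ Complete × c ≢ + 0))

  InC₄ : ℤ → ℤ → ℤ → Set
  InC₄ a b c = a ≢ - b × ¬ Complete × c ≡ + 0

  -- c ≠ (a+b)/2 is written 2c ≠ a + b
  InC₅ : ℤ → ℤ → ℤ → Set
  InC₅ a b c = a ≢ - b × ¬ Complete × (+ 2 * c ≢ a + b) × c ≢ + 0

  -- unbalanced triangle of the first type: exactly one negative edge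
  -- (the vertices are automatically distinct since the diagonal is 0)
  HasUnbalancedTriangle₁ : Set
  HasUnbalancedTriangle₁ = ∃[ i ] ∃[ j ] ∃[ k ] (Neg i j × Pos j k × Pos i k)

{-# OPTIONS --safe #-}
module Submission where

-- A commutes with A² and, by net-regularity, with the all-ones matrix J. Off the
-- diagonal 2A² = κ|A| + (a − b)A + 2cJ with κ = a + b − 2c, so A commutes with κ|A|;
-- the classes C₁, C₄, C₅ force κ ≠ 0 for non-complete graphs. Hence for all x, y the
-- two-paths x–w–y with signs (+,−) and with signs (−,+) are equally many, say N, and
-- with P balanced two-paths an edge xy has P + 2N common neighbours and A²ₓᵧ = P − 2N.
-- In a 6-regular graph P + 2N ≤ 5. On the positive edges kj and ki of the triangle
-- N ≥ 1, which leaves a ∈ {−4, −2, −1, 0} unless both edges have 5 common neighbours,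
-- i.e. N[k] = N[j] = N[i]. Then a and b both lie in {5, 1, −3}; as P + 2N ≡ P − 2N
-- (mod 4), every edge at k has 5 common neighbours too, so N[k] is a clique that is a
-- whole component, contradicting connected and non-complete.

open import Defs
open import Data.Nat using (ℕ)
open import Data.Integer using (ℤ; +_; -_)
open import Data.Product using (_×_)
open import Data.Sum using (_⊎_)
open import Relation.Binary.PropositionalEquality using (_≡_)
open import Relation.Nullary using (¬_)

open import Algebra.Bundles using (Monoid)
import Algebra.Properties.Monoid.Sum as MonoidSum
import Algebra.Properties.Semiring.Sum as SemiringSum
open import Data.Bool.Base using (T)
open import Data.Empty using (⊥-elim)
open import Data.Fin.Base using (Fin; zero; suc)
open import Data.Fin.Properties using (_≟_; suc-injective)
open import Data.Integer.Base using (-[1+_]; ∣_∣)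
import Data.Integer.Base as Int
import Data.Integer.Properties as ℤP
open import Data.Integer.Tactic.RingSolver using (solve-∀)
open import Data.Nat.Base using (zero; suc)
import Data.Nat.Base as Nat
import Data.Nat.Properties as ℕP
import Data.Nat.Tactic.RingSolver as ℕSolver
open import Data.Product using (_,_; proj₁; proj₂)
open import Data.Sum using (inj₁; inj₂; fromInj₂)
import Data.Sum as Sum
open import Function.Base using (_∘_; id)
open import Level using (0ℓ)
open import Relation.Binary.PropositionalEquality
  using (refl; sym; trans; cong; cong₂; subst; _≢_; module ≡-Reasoning)
open import Relation.Nullary using (yes; no)
open import Relation.Unary using (Pred; _∈_; _⊆_; _≐_)

open import Algebra.Properties.AbelianGroup ℤP.+-0-abelianGroup using (inverseˡ-unique)

module ℤΣ = SemiringSum ℤP.+-*-semiring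
module ℕΣ = SemiringSum ℕP.+-*-semiring

module _ {c ℓ} (M : Monoid c ℓ) where
  open Monoid M
  open MonoidSum M using (sum; sum-cong-≋; sum-replicate-zero)
  open import Relation.Binary.Reasoning.Setoid setoid

  sum-single : ∀ {n} (f : Fin n → Carrier) y → (∀ w → w ≢ y → f w ≈ ε) → sum f ≈ f y
  sum-single {suc n} f zero f≈ε = begin
    f zero ∙ sum (f ∘ suc)      ≈⟨ ∙-congˡ (sum-cong-≋ {n} {f ∘ suc} {λ _ → ε} (λ w → f≈ε (suc w) λ ())) ⟩
    f zero ∙ sum {n} (λ _ → ε)  ≈⟨ ∙-congˡ (sum-replicate-zero n) ⟩
    f zero ∙ ε                  ≈⟨ identityʳ (f zero) ⟩
    f zero                      ∎
  sum-single {suc n} f (suc y) f≈ε = begin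
    f zero ∙ sum (f ∘ suc)  ≈⟨ ∙-cong (f≈ε zero λ ()) (sum-single (f ∘ suc) y f∘suc≈ε) ⟩
    ε ∙ f (suc y)           ≈⟨ identityˡ (f (suc y)) ⟩
    f (suc y)               ∎
    where
    f∘suc≈ε : ∀ w → w ≢ y → f (suc w) ≈ ε
    f∘suc≈ε w w≢y = f≈ε (suc w) (w≢y ∘ suc-injective)

module _ where
  open Int using (_+_; _*_; _-_)
  open ℤΣ using (sum; sum-cong-≗; ∑-distrib-+; ∑-comm; *-distribˡ-sum; *-distribʳ-sum)
  open ≡-Reasoning

  sumℤ≡sum : ∀ {n} (f : Fin n → ℤ) → sumℤ f ≡ sum f
  sumℤ≡sum {zero}  f = refl
  sumℤ≡sum {suc n} f = cong (λ s → f zero + s) (sumℤ≡sum (f ∘ suc))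

  sum-neg : ∀ {n} (f : Fin n → ℤ) → sum (λ w → - f w) ≡ - sum f
  sum-neg {zero}  f = refl
  sum-neg {suc n} f =
    trans (cong (λ s → - f zero + s) (sum-neg (f ∘ suc))) (sym (ℤP.neg-distrib-+ (f zero) _))

  sum-− : ∀ {n} (f g : Fin n → ℤ) → sum (λ w → f w - g w) ≡ sum f - sum g
  sum-− f g = trans (∑-distrib-+ f (λ w → - g w)) (cong (λ s → sum f + s) (sum-neg g))

  pos-sum : ∀ {n} (f : Fin n → ℕ) → sum (λ w → + f w) ≡ + ℕΣ.sum f
  pos-sum {zero}  f = refl
  pos-sum {suc n} f = trans (cong (λ s → + f zero + s) (pos-sum (f ∘ suc))) (sym (ℤP.pos-+ (f zero) _))

  Matrix : ℕ → Set
  Matrix n = Fin n → Fin n → ℤ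

  infixl 7 _·_
  _·_ : ∀ {n} → Matrix n → Matrix n → Matrix n
  (L · M) x y = sum (λ w → L x w * M w y)

  ·-assoc : ∀ {n} (L M N : Matrix n) x y → ((L · M) · N) x y ≡ (L · (M · N)) x y
  ·-assoc L M N x y = begin
    sum (λ w → sum (λ u → L x u * M u w) * N w y)
      ≡⟨ sum-cong-≗ (λ w → *-distribʳ-sum (N w y) (λ u → L x u * M u w)) ⟩
    sum (λ w → sum (λ u → L x u * M u w * N w y))
      ≡⟨ ∑-comm (λ w u → L x u * M u w * N w y) ⟩
    sum (λ u → sum (λ w → L x u * M u w * N w y))
      ≡⟨ sum-cong-≗ (λ u → sum-cong-≗ (λ w → ℤP.*-assoc (L x u) (M u w) (N w y))) ⟩
    sum (λ u → sum (λ w → L x u * (M u w * N w y)))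
      ≡⟨ sum-cong-≗ (λ u → *-distribˡ-sum (L x u) (λ w → M u w * N w y)) ⟨
    sum (λ u → L x u * sum (λ w → M u w * N w y))
      ∎

  [_,_] : ∀ {n} → Matrix n → Matrix n → Matrix n
  [ L , M ] x y = sum (λ w → L x w * M w y - M x w * L w y)

  [,]≡·−· : ∀ {n} (L M : Matrix n) x y → [ L , M ] x y ≡ (L · M) x y - (M · L) x y
  [,]≡·−· L M x y = sum-− (λ w → L x w * M w y) (λ w → M x w * L w y)

  [,]-cong : ∀ {n} (L : Matrix n) {M N : Matrix n} → (∀ u v → M u v ≡ N u v) →
             ∀ x y → [ L , M ] x y ≡ [ L , N ] x y
  [,]-cong L M≡N x y = sum-cong-≗ (λ w → cong₂ (λ p q → L x w * p - q * L w y) (M≡N w y) (M≡N x w))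

  [,]-+ : ∀ {n} (L M N : Matrix n) x y →
          [ L , (λ u v → M u v + N u v) ] x y ≡ [ L , M ] x y + [ L , N ] x y
  [,]-+ L M N x y = trans (sum-cong-≗ (λ w → split (L x w) (M w y) (N w y) (M x w) (N x w) (L w y)))
    (∑-distrib-+ (λ w → L x w * M w y - M x w * L w y) (λ w → L x w * N w y - N x w * L w y))
    where
    split : ∀ l m n m′ n′ l′ → l * (m + n) - (m′ + n′) * l′ ≡ (l * m - m′ * l′) + (l * n - n′ * l′)
    split = solve-∀

  [,]-* : ∀ {n} (L M : Matrix n) α x y → [ L , (λ u v → α * M u v) ] x y ≡ α * [ L , M ] x y
  [,]-* L M α x y = trans (sum-cong-≗ (λ w → pull α (L x w) (M w y) (M x w) (L w y)))
    (sym (*-distribˡ-sum α (λ w → L x w * M w y - M x w * L w y)))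
    where
    pull : ∀ α l m m′ l′ → l * (α * m) - (α * m′) * l′ ≡ α * (l * m - m′ * l′)
    pull = solve-∀

  [,]-self : ∀ {n} (L : Matrix n) x y → [ L , L ] x y ≡ + 0
  [,]-self L x y = trans ([,]≡·−· L L x y) (ℤP.+-inverseʳ ((L · L) x y))

  [,]-square : ∀ {n} (L : Matrix n) x y → [ L , L · L ] x y ≡ + 0
  [,]-square L x y = trans ([,]≡·−· L (L · L) x y)
    (trans (cong (_- ((L · L) · L) x y) (sym (·-assoc L L L x y))) (ℤP.+-inverseʳ (((L · L) · L) x y)))

  [,]-constant : ∀ {n} (L : Matrix n) ρ k → (∀ x → sum (L x) ≡ ρ) → (∀ y → sum (λ w → L w y) ≡ ρ) →
                 ∀ x y → [ L , (λ _ _ → k) ] x y ≡ + 0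
  [,]-constant L ρ k rows columns x y = begin
    [ L , (λ _ _ → k) ] x y
      ≡⟨ [,]≡·−· L (λ _ _ → k) x y ⟩
    sum (λ w → L x w * k) - sum (λ w → k * L w y)
      ≡⟨ cong₂ _-_ (sym (*-distribʳ-sum k (L x))) (sym (*-distribˡ-sum k (λ w → L w y))) ⟩
    sum (L x) * k - k * sum (λ w → L w y)
      ≡⟨ cong₂ (λ r s → r * k - k * s) (rows x) (columns y) ⟩
    ρ * k - k * ρ
      ≡⟨ cong (_- k * ρ) (ℤP.*-comm ρ k) ⟩
    k * ρ - k * ρ
      ≡⟨ ℤP.+-inverseʳ (k * ρ) ⟩
    + 0
      ∎

  [,]-scalar : ∀ {n} (L D : Matrix n) d → (∀ u v → u ≢ v → D u v ≡ + 0) → (∀ u → D u u ≡ d) →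
               ∀ x y → [ L , D ] x y ≡ + 0
  [,]-scalar L D d off-diagonal diagonal x y = begin
    [ L , D ] x y
      ≡⟨ [,]≡·−· L D x y ⟩
    sum (λ w → L x w * D w y) - sum (λ w → D x w * L w y)
      ≡⟨ cong₂ _-_ (sum-single ℤP.+-0-monoid _ y LD≈0) (sum-single ℤP.+-0-monoid _ x DL≈0) ⟩
    L x y * D y y - D x x * L x y
      ≡⟨ cong₂ (λ r s → L x y * r - s * L x y) (diagonal y) (diagonal x) ⟩
    L x y * d - d * L x y
      ≡⟨ cong (_- d * L x y) (ℤP.*-comm (L x y) d) ⟩
    d * L x y - d * L x y
      ≡⟨ ℤP.+-inverseʳ (d * L x y) ⟩
    + 0
      ∎
    where
    LD≈0 : ∀ w → w ≢ y → L x w * D w y ≡ + 0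
    LD≈0 w w≢y = trans (cong (L x w *_) (off-diagonal w y w≢y)) (ℤP.*-zeroʳ (L x w))
    DL≈0 : ∀ w → w ≢ x → D x w * L w y ≡ + 0
    DL≈0 w w≢x = trans (cong (_* L w y) (off-diagonal x w (w≢x ∘ sym))) (ℤP.*-zeroˡ (L w y))

module _ where
  open Nat using (_+_; _≤_)
  open ℕΣ using (sum)

  sumℕ≡sum : ∀ {n} (f : Fin n → ℕ) → sumℕ f ≡ sum f
  sumℕ≡sum {zero}  f = refl
  sumℕ≡sum {suc n} f = cong (λ s → f zero + s) (sumℕ≡sum (f ∘ suc))

  sum-point : ∀ {n} (f : Fin n → ℕ) w → f w ≤ sum f
  sum-point f zero    = ℕP.m≤m+n (f zero) _
  sum-point f (suc w) = ℕP.≤-trans (sum-point (f ∘ suc) w) (ℕP.m≤n+m _ (f zero))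

  sum-two-points : ∀ {n} (f : Fin n → ℕ) {w₀ w₁} → w₀ ≢ w₁ → f w₀ + f w₁ ≤ sum f
  sum-two-points f {zero}   {zero}   w₀≢w₁ = ⊥-elim (w₀≢w₁ refl)
  sum-two-points f {zero}   {suc w₁} _     = ℕP.+-monoʳ-≤ (f zero) (sum-point (f ∘ suc) w₁)
  sum-two-points f {suc w₀} {zero}   _     = ℕP.≤-trans (ℕP.≤-reflexive (ℕP.+-comm (f (suc w₀)) (f zero)))
    (ℕP.+-monoʳ-≤ (f zero) (sum-point (f ∘ suc) w₀))
  sum-two-points f {suc w₀} {suc w₁} w₀≢w₁ =
    ℕP.≤-trans (sum-two-points (f ∘ suc) (w₀≢w₁ ∘ cong suc)) (ℕP.m≤n+m _ (f zero))

isBalanced isPlusMinus isMinusPlus : ℤ → ℤ → ℕ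
isBalanced (+ 1)    (+ 1)    = 1
isBalanced -[1+ 0 ] -[1+ 0 ] = 1
isBalanced _        _        = 0
isPlusMinus (+ 1) -[1+ 0 ] = 1
isPlusMinus _     _        = 0
isMinusPlus -[1+ 0 ] (+ 1) = 1
isMinusPlus _        _     = 0

module _ where
  open Int using (_+_; _*_; _-_)

  entry-paths : ∀ {p q} → SignEntry p → SignEntry q →
      p * q ≡ + isBalanced p q - (+ isPlusMinus p q + + isMinusPlus p q)
    × ∣ p ∣ Nat.* ∣ q ∣ ≡ isBalanced p q Nat.+ (isPlusMinus p q Nat.+ isMinusPlus p q)
    × p * + ∣ q ∣ - + ∣ p ∣ * q ≡ + 2 * (+ isPlusMinus p q - + isMinusPlus p q)
  entry-paths (inj₁ refl)        (inj₁ refl)        = refl , refl , refl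
  entry-paths (inj₁ refl)        (inj₂ (inj₁ refl)) = refl , refl , refl
  entry-paths (inj₁ refl)        (inj₂ (inj₂ refl)) = refl , refl , refl
  entry-paths (inj₂ (inj₁ refl)) (inj₁ refl)        = refl , refl , refl
  entry-paths (inj₂ (inj₁ refl)) (inj₂ (inj₁ refl)) = refl , refl , refl
  entry-paths (inj₂ (inj₁ refl)) (inj₂ (inj₂ refl)) = refl , refl , refl
  entry-paths (inj₂ (inj₂ refl)) (inj₁ refl)        = refl , refl , refl
  entry-paths (inj₂ (inj₂ refl)) (inj₂ (inj₁ refl)) = refl , refl , refl
  entry-paths (inj₂ (inj₂ refl)) (inj₂ (inj₂ refl)) = refl , refl , refl

module Graph {n : ℕ} (G : SignedGraph n) where

  ∣A∣ : Fin n → Fin n → ℕ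
  ∣A∣ x y = ∣ A G x y ∣

  ∣A∣ℤ : Matrix n
  ∣A∣ℤ x y = + ∣A∣ x y

  infix 4 _~_
  _~_ : Fin n → Fin n → Set
  x ~ y = ∣A∣ x y ≡ 1

  ∣A∣≡0⊎~ : ∀ x y → ∣A∣ x y ≡ 0 ⊎ x ~ y
  ∣A∣≡0⊎~ x y with entries G x y
  ... | inj₁ x≁y        = inj₁ (cong ∣_∣ x≁y)
  ... | inj₂ (inj₁ x+y) = inj₂ (cong ∣_∣ x+y)
  ... | inj₂ (inj₂ x-y) = inj₂ (cong ∣_∣ x-y)

  ∣A∣-sym : ∀ x y → ∣A∣ x y ≡ ∣A∣ y x
  ∣A∣-sym x y = cong ∣_∣ (symm G x y)

  ∣A∣-diag : ∀ x → ∣A∣ x x ≡ 0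
  ∣A∣-diag x = cong ∣_∣ (loopless G x)

  ~-sym : ∀ {x y} → x ~ y → y ~ x
  ~-sym {x} {y} = trans (∣A∣-sym y x)

  Adj⇒~ : ∀ {x y} → Adj G x y → x ~ y
  Adj⇒~ {x} {y} adj with ∣A∣≡0⊎~ x y
  ... | inj₁ ∣A∣≡0 = ⊥-elim (adj (ℤP.∣i∣≡0⇒i≡0 ∣A∣≡0))
  ... | inj₂ x~y   = x~y

  ~⇒Adj : ∀ {x y} → x ~ y → Adj G x y
  ~⇒Adj x~y A≡0 = ℕP.0≢1+n (trans (sym (cong ∣_∣ A≡0)) x~y)

  N[_] : Fin n → Pred (Fin n) 0ℓ
  N[ x ] w = x ≡ w ⊎ x ~ w

  N[]⇒~ : ∀ {x y} → y ∈ N[ x ] → x ≢ y → x ~ y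
  N[]⇒~ (inj₁ x≡y) x≢y = ⊥-elim (x≢y x≡y)
  N[]⇒~ (inj₂ x~y) _   = x~y

  complete-if-neighbours-twins : Connected G → ∀ k → (∀ {x} → k ~ x → N[ x ] ≐ N[ k ]) → Complete G
  complete-if-neighbours-twins connected k twins u v u≢v =
    ~⇒Adj (N[]⇒~ (N[k]⊆N[ u ] (in-N[k] u) (in-N[k] v)) u≢v)
    where
    N[_]⊆N[k] : ∀ x → x ∈ N[ k ] → N[ x ] ⊆ N[ k ]
    N[ _ ]⊆N[k] (inj₁ refl) = id
    N[ _ ]⊆N[k] (inj₂ k~x)  = proj₁ (twins k~x)

    N[k]⊆N[_] : ∀ x → x ∈ N[ k ] → N[ k ] ⊆ N[ x ]
    N[k]⊆N[ _ ] (inj₁ refl) = id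
    N[k]⊆N[ _ ] (inj₂ k~x)  = proj₂ (twins k~x)

    reachable : ∀ {x y} → Walk G x y → x ∈ N[ k ] → y ∈ N[ k ]
    reachable here           x∈N[k] = x∈N[k]
    reachable (step adj x⇝y) x∈N[k] = reachable x⇝y (N[ _ ]⊆N[k] x∈N[k] (inj₂ (Adj⇒~ adj)))

    in-N[k] : ∀ x → x ∈ N[ k ]
    in-N[k] x = reachable (connected k x) (inj₁ refl)

  common : Fin n → Fin n → ℕ
  common x y = ℕΣ.sum (λ w → ∣A∣ x w Nat.* ∣A∣ w y)

  common-sym : ∀ x y → common x y ≡ common y x
  common-sym x y = ℕΣ.sum-cong-≗ λ w →
    trans (cong₂ Nat._*_ (∣A∣-sym x w) (∣A∣-sym w y)) (ℕP.*-comm (∣A∣ w x) (∣A∣ y w))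

  2≤common : ∀ {x y w₀ w₁} → w₀ ≢ w₁ → x ~ w₀ → w₀ ~ y → x ~ w₁ → w₁ ~ y →
             2 Nat.≤ common x y
  2≤common {x} {y} w₀≢w₁ x~w₀ w₀~y x~w₁ w₁~y =
    subst (Nat._≤ common x y) (cong₂ Nat._+_ (cong₂ Nat._*_ x~w₀ w₀~y) (cong₂ Nat._*_ x~w₁ w₁~y))
      (sum-two-points (λ w → ∣A∣ x w Nat.* ∣A∣ w y) w₀≢w₁)

  balanced plusMinus minusPlus : Fin n → Fin n → ℕ
  balanced  x y = ℕΣ.sum (λ w → isBalanced  (A G x w) (A G w y))
  plusMinus x y = ℕΣ.sum (λ w → isPlusMinus (A G x w) (A G w y))
  minusPlus x y = ℕΣ.sum (λ w → isMinusPlus (A G x w) (A G w y))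

  1≤plusMinus : ∀ {x y w} → A G x w ≡ + 1 → A G w y ≡ - + 1 → 1 Nat.≤ plusMinus x y
  1≤plusMinus {x} {y} {w} x+w w-y = subst (Nat._≤ plusMinus x y) (cong₂ isPlusMinus x+w w-y)
    (sum-point (λ u → isPlusMinus (A G x u) (A G u y)) w)

  module _ (x y : Fin n) where
    open Int using (_+_; _*_; _-_)
    open ℤΣ using (sum; sum-cong-≗; ∑-distrib-+)
    open ≡-Reasoning

    private
      b m p : Fin n → ℕ
      b w = isBalanced  (A G x w) (A G w y)
      p w = isPlusMinus (A G x w) (A G w y)
      m w = isMinusPlus (A G x w) (A G w y)

    A²≡· : A² G x y ≡ (A G · A G) x y
    A²≡· = sumℤ≡sum (λ w → A G x w * A G w y)

    A²≡paths : A² G x y ≡ + balanced x y - (+ plusMinus x y + + minusPlus x y)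
    A²≡paths = begin
      A² G x y
        ≡⟨ A²≡· ⟩
      sum (λ w → A G x w * A G w y)
        ≡⟨ sum-cong-≗ (λ w → proj₁ (entry-paths (entries G x w) (entries G w y))) ⟩
      sum (λ w → + b w - (+ p w + + m w))
        ≡⟨ sum-− (λ w → + b w) (λ w → + p w + + m w) ⟩
      sum (λ w → + b w) - sum (λ w → + p w + + m w)
        ≡⟨ cong (λ t → sum (λ w → + b w) - t) (∑-distrib-+ (λ w → + p w) (λ w → + m w)) ⟩
      sum (λ w → + b w) - (sum (λ w → + p w) + sum (λ w → + m w))
        ≡⟨ cong₂ _-_ (pos-sum b) (cong₂ _+_ (pos-sum p) (pos-sum m)) ⟩
      + balanced x y - (+ plusMinus x y + + minusPlus x y)
        ∎

    common≡paths : common x y ≡ balanced x y Nat.+ (plusMinus x y Nat.+ minusPlus x y)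
    common≡paths = trans (ℕΣ.sum-cong-≗ (λ w → proj₁ (proj₂ (entry-paths (entries G x w) (entries G w y)))))
      (trans (ℕΣ.∑-distrib-+ b (λ w → p w Nat.+ m w)) (cong (balanced x y Nat.+_) (ℕΣ.∑-distrib-+ p m)))

    [A,∣A∣]≡paths : [ A G , ∣A∣ℤ ] x y ≡ + 2 * (+ plusMinus x y - + minusPlus x y)
    [A,∣A∣]≡paths = begin
      [ A G , ∣A∣ℤ ] x y
        ≡⟨ sum-cong-≗ (λ w → proj₂ (proj₂ (entry-paths (entries G x w) (entries G w y)))) ⟩
      sum (λ w → + 2 * (+ p w - + m w))
        ≡⟨ ℤΣ.*-distribˡ-sum (+ 2) (λ w → + p w - + m w) ⟨
      + 2 * sum (λ w → + p w - + m w)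
        ≡⟨ cong (+ 2 *_) (sum-− (λ w → + p w) (λ w → + m w)) ⟩
      + 2 * (sum (λ w → + p w) - sum (λ w → + m w))
        ≡⟨ cong₂ (λ s t → + 2 * (s - t)) (pos-sum p) (pos-sum m) ⟩
      + 2 * (+ plusMinus x y - + minusPlus x y)
        ∎

  module Regularity (r : ℕ) (regular : Regular G r) where
    open Nat using (_+_; _*_; _∸_; _≤_)
    open ℕΣ using (sum; sum-cong-≗; ∑-distrib-+)

    private
      exclusive : Fin n → Fin n → ℕ
      exclusive x y = sum (λ w → ∣A∣ x w * (1 ∸ ∣A∣ w y))

      common+exclusive : ∀ x y → common x y + exclusive x y ≡ r
      common+exclusive x y = begin
        common x y + exclusive x y
          ≡⟨ ∑-distrib-+ (λ w → ∣A∣ x w * ∣A∣ w y) (λ w → ∣A∣ x w * (1 ∸ ∣A∣ w y)) ⟨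
        sum (λ w → ∣A∣ x w * ∣A∣ w y + ∣A∣ x w * (1 ∸ ∣A∣ w y))
          ≡⟨ sum-cong-≗ (λ w → split (∣A∣ x w) (∣A∣≡0⊎~ w y)) ⟩
        sum (∣A∣ x)
          ≡⟨ sumℕ≡sum (∣A∣ x) ⟨
        deg G x
          ≡⟨ regular x ⟩
        r
          ∎
        where
        open ≡-Reasoning
        split : ∀ {q} m → q ≡ 0 ⊎ q ≡ 1 → m * q + m * (1 ∸ q) ≡ m
        split m (inj₁ refl) = trans (cong (_+ m * 1) (ℕP.*-zeroʳ m)) (ℕP.*-identityʳ m)
        split m (inj₂ refl) =
          trans (cong (λ t → m * 1 + t) (ℕP.*-zeroʳ m)) (trans (ℕP.+-identityʳ (m * 1)) (ℕP.*-identityʳ m))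

      exclusive-term : ∀ {x w y} → x ~ w → ∣A∣ w y ≡ 0 → ∣A∣ x w * (1 ∸ ∣A∣ w y) ≡ 1
      exclusive-term x~w ∣A∣≡0 = cong₂ (λ p q → p * (1 ∸ q)) x~w ∣A∣≡0

      saturated⇒exclusive≡1 : ∀ x y → suc (common x y) ≡ r → exclusive x y ≡ 1
      saturated⇒exclusive≡1 x y saturated = ℕP.+-cancelˡ-≡ (common x y) _ _
        (trans (common+exclusive x y) (trans (sym saturated) (ℕP.+-comm 1 (common x y))))

    common<r : ∀ {x y} → x ~ y → suc (common x y) ≤ r
    common<r {x} {y} x~y = begin
      suc (common x y)            ≡⟨ ℕP.+-comm 1 (common x y) ⟩
      common x y + 1              ≤⟨ ℕP.+-monoʳ-≤ (common x y) 1≤exclusive ⟩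
      common x y + exclusive x y  ≡⟨ common+exclusive x y ⟩
      r                           ∎
      where
      open ℕP.≤-Reasoning
      1≤exclusive : 1 ≤ exclusive x y
      1≤exclusive = subst (_≤ exclusive x y) (exclusive-term x~y (∣A∣-diag y))
        (sum-point (λ w → ∣A∣ x w * (1 ∸ ∣A∣ w y)) y)

    saturated⇒⊆ : ∀ {x y} → x ~ y → suc (common x y) ≡ r → N[ x ] ⊆ N[ y ]
    saturated⇒⊆ x~y _ (inj₁ refl) = inj₂ (~-sym x~y)
    saturated⇒⊆ {x} {y} x~y saturated {w} (inj₂ x~w) with w ≟ y | ∣A∣≡0⊎~ w y
    ... | yes refl | _          = inj₁ refl
    ... | no _     | inj₂ w~y   = inj₂ (~-sym w~y)
    ... | no w≢y   | inj₁ ∣A∣≡0 =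
      ⊥-elim (ℕP.<-irrefl refl (subst (2 ≤_) (saturated⇒exclusive≡1 x y saturated) 2≤exclusive))
      where
      2≤exclusive : 2 ≤ exclusive x y
      2≤exclusive = subst (_≤ exclusive x y) (cong₂ _+_ (exclusive-term x~w ∣A∣≡0) (exclusive-term x~y (∣A∣-diag y)))
        (sum-two-points (λ u → ∣A∣ x u * (1 ∸ ∣A∣ u y)) w≢y)

    ⊆⇒saturated : ∀ {x y} → x ~ y → N[ x ] ⊆ N[ y ] → suc (common x y) ≡ r
    ⊆⇒saturated {x} {y} x~y N[x]⊆N[y] = begin
      suc (common x y)            ≡⟨ ℕP.+-comm 1 (common x y) ⟩
      common x y + 1              ≡⟨ cong (λ e → common x y + e) exclusive≡1 ⟨
      common x y + exclusive x y  ≡⟨ common+exclusive x y ⟩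
      r                           ∎
      where
      open ≡-Reasoning
      vanishes : ∀ w → w ≢ y → ∣A∣ x w * (1 ∸ ∣A∣ w y) ≡ 0
      vanishes w w≢y with ∣A∣≡0⊎~ x w
      ... | inj₁ ∣A∣≡0 = cong (_* (1 ∸ ∣A∣ w y)) ∣A∣≡0
      ... | inj₂ x~w   = trans (cong (λ q → ∣A∣ x w * (1 ∸ q)) w~y) (ℕP.*-zeroʳ (∣A∣ x w))
        where
        w~y : w ~ y
        w~y = ~-sym (N[]⇒~ (N[x]⊆N[y] (inj₂ x~w)) (w≢y ∘ sym))
      exclusive≡1 : exclusive x y ≡ 1
      exclusive≡1 = trans (sum-single ℕP.+-0-monoid _ y vanishes) (exclusive-term x~y (∣A∣-diag y))

    ⊆-sym : ∀ {x y} → x ~ y → N[ x ] ⊆ N[ y ] → N[ y ] ⊆ N[ x ]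
    ⊆-sym {x} {y} x~y N[x]⊆N[y] =
      saturated⇒⊆ (~-sym x~y) (trans (cong suc (common-sym y x)) (⊆⇒saturated x~y N[x]⊆N[y]))

  module StronglyRegular (r : ℕ) (a b c ρ : ℤ)
    (diagonal    : ∀ x → A² G x x ≡ + r)
    (positive    : ∀ x y → Pos G x y → A² G x y ≡ a)
    (negative    : ∀ x y → Neg G x y → A² G x y ≡ b)
    (nonadjacent : ∀ x y → x ≢ y → A G x y ≡ + 0 → A² G x y ≡ c)
    (netRegular  : NetRegular G ρ)
    where
    open Int using (_+_; _*_; _-_)

    A²-on-edge : ∀ {x y} → x ~ y → A² G x y ≡ a ⊎ A² G x y ≡ b
    A²-on-edge {x} {y} x~y with entries G x y
    ... | inj₁ x≁y        = ⊥-elim (~⇒Adj x~y x≁y)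
    ... | inj₂ (inj₁ x+y) = inj₁ (positive x y x+y)
    ... | inj₂ (inj₂ x-y) = inj₂ (negative x y x-y)

    κ : ℤ
    κ = a + b - + 2 * c

    2A²-off-diagonal : ∀ {x y} → x ≢ y → + 2 * A² G x y ≡ κ * ∣A∣ℤ x y + ((a - b) * A G x y + + 2 * c)
    2A²-off-diagonal {x} {y} x≢y with entries G x y
    ... | inj₁ x≁y        rewrite x≁y | nonadjacent x y x≢y x≁y = at-0 a b c
      where
      at-0 : ∀ a b c → + 2 * c ≡ (a + b - + 2 * c) * + 0 + ((a - b) * + 0 + + 2 * c)
      at-0 = solve-∀
    ... | inj₂ (inj₁ x+y) rewrite x+y | positive x y x+y = at-+1 a b c
      where
      at-+1 : ∀ a b c → + 2 * a ≡ (a + b - + 2 * c) * + 1 + ((a - b) * + 1 + + 2 * c)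
      at-+1 = solve-∀
    ... | inj₂ (inj₂ x-y) rewrite x-y | negative x y x-y = at-−1 a b c
      where
      at-−1 : ∀ a b c → + 2 * b ≡ (a + b - + 2 * c) * + 1 + ((a - b) * - + 1 + + 2 * c)
      at-−1 = solve-∀

    -- By 2A²-off-diagonal the residual 2A² − κ|A| − S is a scalar matrix.
    private
      S residual : Matrix n
      S x y = (a - b) * A G x y + + 2 * c
      residual x y = + 2 * A² G x y - (κ * ∣A∣ℤ x y + S x y)

      [A,S]≡0 : ∀ x y → [ A G , S ] x y ≡ + 0
      [A,S]≡0 x y = begin
        [ A G , S ] x y
          ≡⟨ [,]-+ (A G) (λ u v → (a - b) * A G u v) (λ _ _ → + 2 * c) x y ⟩
        [ A G , (λ u v → (a - b) * A G u v) ] x y + [ A G , (λ _ _ → + 2 * c) ] x y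
          ≡⟨ cong₂ _+_ ([,]-* (A G) (A G) (a - b) x y) ([,]-constant (A G) ρ (+ 2 * c) rows columns x y) ⟩
        (a - b) * [ A G , A G ] x y + + 0
          ≡⟨ cong (λ t → (a - b) * t + + 0) ([,]-self (A G) x y) ⟩
        (a - b) * + 0 + + 0
          ≡⟨ cong (_+ + 0) (ℤP.*-zeroʳ (a - b)) ⟩
        + 0
          ∎
        where
        open ≡-Reasoning
        rows : ∀ x → ℤΣ.sum (A G x) ≡ ρ
        rows x = trans (sym (sumℤ≡sum (A G x))) (netRegular x)
        columns : ∀ y → ℤΣ.sum (λ w → A G w y) ≡ ρ
        columns y = trans (ℤΣ.sum-cong-≗ (λ w → symm G w y)) (rows y)

      [A,residual]≡0 : ∀ x y → [ A G , residual ] x y ≡ + 0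
      [A,residual]≡0 = [,]-scalar (A G) residual (+ 2 * + r - + 2 * c) off-diagonal on-diagonal
        where
        off-diagonal : ∀ x y → x ≢ y → residual x y ≡ + 0
        off-diagonal x y x≢y = ℤP.i≡j⇒i-j≡0 (2A²-off-diagonal x≢y)
        on-diagonal : ∀ x → residual x x ≡ + 2 * + r - + 2 * c
        on-diagonal x rewrite diagonal x | loopless G x = at-diagonal κ (a - b) c (+ 2 * + r)
          where
          at-diagonal : ∀ κ d c t → t - (κ * + 0 + (d * + 0 + + 2 * c)) ≡ t - + 2 * c
          at-diagonal = solve-∀

    κ[A,∣A∣]≡0 : ∀ x y → κ * [ A G , ∣A∣ℤ ] x y ≡ + 0
    κ[A,∣A∣]≡0 x y = begin
      κ * [ A G , ∣A∣ℤ ] x y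
        ≡⟨ trans (ℤP.+-identityʳ _) (ℤP.+-identityʳ _) ⟨
      (κ * [ A G , ∣A∣ℤ ] x y + + 0) + + 0
        ≡⟨ cong₂ (λ s t → (κ * [ A G , ∣A∣ℤ ] x y + s) + t) ([A,S]≡0 x y) ([A,residual]≡0 x y) ⟨
      (κ * [ A G , ∣A∣ℤ ] x y + [ A G , S ] x y) + [ A G , residual ] x y
        ≡⟨ cong (λ t → (t + [ A G , S ] x y) + [ A G , residual ] x y) ([,]-* (A G) ∣A∣ℤ κ x y) ⟨
      ([ A G , κ∣A∣ ] x y + [ A G , S ] x y) + [ A G , residual ] x y
        ≡⟨ cong (_+ [ A G , residual ] x y) ([,]-+ (A G) κ∣A∣ S x y) ⟨
      [ A G , (λ u v → κ∣A∣ u v + S u v) ] x y + [ A G , residual ] x y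
        ≡⟨ [,]-+ (A G) (λ u v → κ∣A∣ u v + S u v) residual x y ⟨
      [ A G , (λ u v → (κ∣A∣ u v + S u v) + residual u v) ] x y
        ≡⟨ [,]-cong (A G) (λ u v → sym (decompose u v)) x y ⟩
      [ A G , (λ u v → + 2 * (A G · A G) u v) ] x y
        ≡⟨ [,]-* (A G) (A G · A G) (+ 2) x y ⟩
      + 2 * [ A G , A G · A G ] x y
        ≡⟨ cong (+ 2 *_) ([,]-square (A G) x y) ⟩
      + 0
        ∎
      where
      open ≡-Reasoning
      κ∣A∣ : Matrix n
      κ∣A∣ u v = κ * ∣A∣ℤ u v
      decompose : ∀ u v → + 2 * (A G · A G) u v ≡ (κ∣A∣ u v + S u v) + residual u v
      decompose u v = trans (cong (+ 2 *_) (sym (A²≡· u v))) (x≡y+[x-y] (+ 2 * A² G u v) (κ∣A∣ u v + S u v))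
        where
        x≡y+[x-y] : ∀ x y → x ≡ y + (x - y)
        x≡y+[x-y] = solve-∀

    plusMinus≡minusPlus : + 2 * c ≢ a + b → ∀ x y → plusMinus x y ≡ minusPlus x y
    plusMinus≡minusPlus 2c≢a+b x y =
      ℤP.+-injective (ℤP.i-j≡0⇒i≡j (+ plusMinus x y) (+ minusPlus x y) p-m≡0)
      where
      p-m : ℤ
      p-m = + plusMinus x y - + minusPlus x y
      cancel : ∀ {i} j → i ≢ + 0 → i * j ≡ + 0 → j ≡ + 0
      cancel {i} j i≢0 ij≡0 = fromInj₂ (⊥-elim ∘ i≢0) (ℤP.i*j≡0⇒i≡0∨j≡0 i {j} ij≡0)
      κ≢0 : κ ≢ + 0
      κ≢0 κ≡0 = 2c≢a+b (sym (ℤP.i-j≡0⇒i≡j (a + b) (+ 2 * c) κ≡0))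
      κ2[p-m]≡0 : κ * (+ 2 * p-m) ≡ + 0
      κ2[p-m]≡0 = trans (cong (κ *_) (sym ([A,∣A∣]≡paths x y))) (κ[A,∣A∣]≡0 x y)
      p-m≡0 : p-m ≡ + 0
      p-m≡0 = cancel {+ 2} p-m (λ ()) (cancel {κ} (+ 2 * p-m) κ≢0 κ2[p-m]≡0)

-- An edge with N two-paths of each unbalanced sign pattern and P balanced ones has
-- count N P common neighbours and A²-entry value N P. Writing the factor as N * 2 makes
-- count N P ≤ᵇ 5 compute on numerals, so the coverage checker discards the out-of-range
-- profiles in the case splits below.
count : ℕ → ℕ → ℕ
count N P = N Nat.* 2 Nat.+ P

value : ℕ → ℕ → ℤ
value N P = + P Int.- + (N Nat.* 2)

Allowed : ℤ → Set
Allowed a = a ≡ - (+ 4) ⊎ a ≡ - (+ 2) ⊎ a ≡ - (+ 1) ⊎ a ≡ + 0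

data SaturatedValue : ℤ → Set where
  five        : SaturatedValue (+ 5)
  one         : SaturatedValue (+ 1)
  minus-three : SaturatedValue (- + 3)

module _ where
  open Nat using (_≤_; _≤ᵇ_)

  allowed-or-saturated : ∀ N P → 1 ≤ N → count N P ≤ 5 → Allowed (value N P) ⊎ count N P ≡ 5
  allowed-or-saturated N P 1≤N ≤5 = cases N P 1≤N (ℕP.≤⇒≤ᵇ ≤5)
    where
    cases : ∀ N P → 1 ≤ N → T (count N P ≤ᵇ 5) → Allowed (value N P) ⊎ count N P ≡ 5
    cases 1 0 _ _ = inj₁ (inj₂ (inj₁ refl))
    cases 1 1 _ _ = inj₁ (inj₂ (inj₂ (inj₁ refl)))
    cases 1 2 _ _ = inj₁ (inj₂ (inj₂ (inj₂ refl)))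
    cases 1 3 _ _ = inj₂ refl
    cases 2 0 _ _ = inj₁ (inj₁ refl)
    cases 2 1 _ _ = inj₂ refl

  saturated⇒saturatedValue : ∀ N P → count N P ≡ 5 → SaturatedValue (value N P)
  saturated⇒saturatedValue 0 _ refl = five
  saturated⇒saturatedValue 1 _ refl = one
  saturated⇒saturatedValue 2 _ refl = minus-three

  saturatedValue⇒saturated : ∀ N P → SaturatedValue (value N P) → 2 ≤ count N P → count N P ≤ 5 →
                             count N P ≡ 5
  saturatedValue⇒saturated N P v 2≤ ≤5 = cases N P v (ℕP.≤⇒≤ᵇ 2≤) (ℕP.≤⇒≤ᵇ ≤5)
    where
    cases : ∀ N P → SaturatedValue (value N P) → T (2 ≤ᵇ count N P) → T (count N P ≤ᵇ 5) → count N P ≡ 5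
    cases 0 5 _ _ _ = refl
    cases 1 3 _ _ _ = refl
    cases 2 1 _ _ _ = refl

module SixRegular {n : ℕ} (G : SignedGraph n) (a b c : ℤ)
  (diagonal    : ∀ x → A² G x x ≡ + 6)
  (positive    : ∀ x y → Pos G x y → A² G x y ≡ a)
  (negative    : ∀ x y → Neg G x y → A² G x y ≡ b)
  (nonadjacent : ∀ x y → x ≢ y → A G x y ≡ + 0 → A² G x y ≡ c)
  (regular     : Regular G 6)
  (ρ           : ℤ)
  (netRegular  : NetRegular G ρ)
  (2c≢a+b      : + 2 Int.* c ≢ a Int.+ b)
  where
  open Graph G
  open Regularity 6 regular
  open StronglyRegular 6 a b c ρ diagonal positive negative nonadjacent netRegular
  open Nat using (_≤_)

  A²≡value : ∀ x y → A² G x y ≡ value (plusMinus x y) (balanced x y)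
  A²≡value x y = begin
    A² G x y
      ≡⟨ A²≡paths x y ⟩
    + balanced x y - (+ plusMinus x y + + minusPlus x y)
      ≡⟨ cong (λ m → + balanced x y - (+ plusMinus x y + + m)) (plusMinus≡minusPlus 2c≢a+b x y) ⟨
    + balanced x y - (+ plusMinus x y + + plusMinus x y)
      ≡⟨ cong (λ m → + balanced x y - m) (ℤP.pos-+ (plusMinus x y) (plusMinus x y)) ⟨
    + balanced x y - + (plusMinus x y Nat.+ plusMinus x y)
      ≡⟨ cong (λ m → + balanced x y - + m) (double (plusMinus x y)) ⟩
    value (plusMinus x y) (balanced x y)
      ∎
    where
    open ≡-Reasoning
    open Int using (_+_; _-_)
    double : ∀ m → m Nat.+ m ≡ m Nat.* 2
    double = ℕSolver.solve-∀

  common≡count : ∀ x y → common x y ≡ count (plusMinus x y) (balanced x y)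
  common≡count x y = trans (common≡paths x y)
    (trans (cong (λ m → balanced x y Nat.+ (plusMinus x y Nat.+ m)) (sym (plusMinus≡minusPlus 2c≢a+b x y)))
      (reorder (balanced x y) (plusMinus x y)))
    where
    reorder : ∀ p m → p Nat.+ (m Nat.+ m) ≡ m Nat.* 2 Nat.+ p
    reorder = ℕSolver.solve-∀

  count≤5 : ∀ {x y} → x ~ y → count (plusMinus x y) (balanced x y) ≤ 5
  count≤5 {x} {y} x~y = subst (_≤ 5) (common≡count x y) (Nat.s≤s⁻¹ (common<r x~y))

  allowed-or-⊆ : ∀ {x y w} → Pos G x y → A G x w ≡ + 1 → A G w y ≡ - + 1 →
                 Allowed a ⊎ N[ x ] ⊆ N[ y ]
  allowed-or-⊆ {x} {y} {w} x+y x+w w-y =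
    Sum.map (subst Allowed value≡a) (λ count≡5 → saturated⇒⊆ x~y (cong suc (trans (common≡count x y) count≡5)))
      (allowed-or-saturated (plusMinus x y) (balanced x y) (1≤plusMinus {x} {y} {w} x+w w-y) (count≤5 x~y))
    where
    x~y : x ~ y
    x~y = cong ∣_∣ x+y
    value≡a : value (plusMinus x y) (balanced x y) ≡ a
    value≡a = trans (sym (A²≡value x y)) (positive x y x+y)

  ⊆⇒saturatedValue : ∀ {x y} → x ~ y → N[ x ] ⊆ N[ y ] → SaturatedValue (A² G x y)
  ⊆⇒saturatedValue {x} {y} x~y N[x]⊆N[y] = subst SaturatedValue (sym (A²≡value x y))
    (saturated⇒saturatedValue (plusMinus x y) (balanced x y)
      (trans (sym (common≡count x y)) (ℕP.suc-injective (⊆⇒saturated x~y N[x]⊆N[y]))))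

  saturatedValue⇒⊆ : ∀ {x y} → x ~ y → SaturatedValue (A² G x y) → 2 ≤ common x y → N[ x ] ⊆ N[ y ]
  saturatedValue⇒⊆ {x} {y} x~y v 2≤common = saturated⇒⊆ x~y (cong suc (trans (common≡count x y)
    (saturatedValue⇒saturated (plusMinus x y) (balanced x y) (subst SaturatedValue (A²≡value x y) v)
      (subst (2 ≤_) (common≡count x y) 2≤common) (count≤5 x~y))))

  ⊆-triangle⇒complete : Connected G → ∀ {i j k} → Neg G i j → Pos G k j → Pos G k i →
                        N[ k ] ⊆ N[ j ] → N[ k ] ⊆ N[ i ] → Complete G
  ⊆-triangle⇒complete connected {i} {j} {k} i-j k+j k+i N[k]⊆N[j] N[k]⊆N[i] =
    complete-if-neighbours-twins connected k λ k~x → ⊆-sym k~x (N[k]⊆N[ _ ] k~x) , N[k]⊆N[ _ ] k~x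
    where
    k~j : k ~ j
    k~j = cong ∣_∣ k+j
    k~i : k ~ i
    k~i = cong ∣_∣ k+i
    i~j : i ~ j
    i~j = cong ∣_∣ i-j

    i≢j : i ≢ j
    i≢j refl = ℕP.0≢1+n (trans (sym (∣A∣-diag i)) i~j)

    a-saturated : SaturatedValue a
    a-saturated = subst SaturatedValue (positive k j k+j) (⊆⇒saturatedValue k~j N[k]⊆N[j])

    b-saturated : SaturatedValue b
    b-saturated = subst SaturatedValue (negative i j i-j)
      (⊆⇒saturatedValue i~j (N[k]⊆N[j] ∘ ⊆-sym k~i N[k]⊆N[i]))

    edge-saturated : ∀ {x} → k ~ x → SaturatedValue (A² G k x)
    edge-saturated k~x with A²-on-edge k~x
    ... | inj₁ A²≡a = subst SaturatedValue (sym A²≡a) a-saturated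
    ... | inj₂ A²≡b = subst SaturatedValue (sym A²≡b) b-saturated

    N[k]⊆N[_] : ∀ x → k ~ x → N[ k ] ⊆ N[ x ]
    N[k]⊆N[ x ] k~x with x ≟ i | x ≟ j
    ... | yes refl | _        = N[k]⊆N[i]
    ... | no _     | yes refl = N[k]⊆N[j]
    ... | no x≢i   | no x≢j   = saturatedValue⇒⊆ k~x (edge-saturated k~x) (2≤common i≢j k~i i~x k~j j~x)
      where
      i~x : i ~ x
      i~x = N[]⇒~ (N[k]⊆N[i] (inj₂ k~x)) (x≢i ∘ sym)
      j~x : j ~ x
      j~x = N[]⇒~ (N[k]⊆N[j] (inj₂ k~x)) (x≢j ∘ sym)

classes⇒2c≢a+b : ∀ {n} (G : SignedGraph n) a b c → ¬ Complete G →
                 InC₁ G a b c ⊎ InC₄ G a b c ⊎ InC₅ G a b c → + 2 Int.* c ≢ a Int.+ b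
classes⇒2c≢a+b G a b c ¬complete (inj₁ (_ , inj₁ complete)) = ⊥-elim (¬complete complete)
classes⇒2c≢a+b G a b c _ (inj₁ (a≡-b , inj₂ (_ , c≢0))) 2c≡a+b
  with ℤP.i*j≡0⇒i≡0∨j≡0 (+ 2) (trans 2c≡a+b (trans (cong (Int._+ b) a≡-b) (ℤP.+-inverseˡ b)))
... | inj₂ c≡0 = c≢0 c≡0
classes⇒2c≢a+b G a b c _ (inj₂ (inj₁ (a≢-b , _ , c≡0))) 2c≡a+b =
  a≢-b (inverseˡ-unique a b (trans (sym 2c≡a+b) (cong (+ 2 Int.*_) c≡0)))
classes⇒2c≢a+b G a b c _ (inj₂ (inj₂ (_ , _ , 2c≢a+b , _))) = 2c≢a+b

lemma3p5 : (n : ℕ) (G : SignedGraph n) (a b c : ℤ) →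
    ¬ Homogeneous G →
    SRSG G 6 a b c →
    (InC₁ G a b c ⊎ InC₄ G a b c ⊎ InC₅ G a b c) →
    Connected G → ¬ Complete G → Regular G 6 → NetRegular G (+ 2) →
    HasUnbalancedTriangle₁ G →
    a ≡ - (+ 4) ⊎ a ≡ - (+ 2) ⊎ a ≡ - (+ 1) ⊎ a ≡ + 0
lemma3p5 n G a b c _ (_ , _ , diagonal , positive , negative , nonadjacent) classes connected ¬complete
  regular netRegular (i , j , k , i-j , j+k , i+k) =
  conclude (allowed-or-⊆ k+j k+i i-j) (allowed-or-⊆ k+i k+j j-i)
  where
  open Graph G using (N[_])
  open SixRegular G a b c diagonal positive negative nonadjacent regular (+ 2) netRegular
    (classes⇒2c≢a+b G a b c ¬complete classes)

  k+j : Pos G k j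
  k+j = trans (symm G k j) j+k
  k+i : Pos G k i
  k+i = trans (symm G k i) i+k
  j-i : Neg G j i
  j-i = trans (symm G j i) i-j

  conclude : Allowed a ⊎ N[ k ] ⊆ N[ j ] → Allowed a ⊎ N[ k ] ⊆ N[ i ] → Allowed a
  conclude (inj₁ allowed)   _                = allowed
  conclude (inj₂ _)         (inj₁ allowed)   = allowed
  conclude (inj₂ N[k]⊆N[j]) (inj₂ N[k]⊆N[i]) =
    ⊥-elim (¬complete (⊆-triangle⇒complete connected i-j k+j k+i N[k]⊆N[j] N[k]⊆N[i]))
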